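{- Let $2\le k<g$ be integers such that $Y(g,k)$ is a complete Young graph. Then for every node of $Y(g,k)$ of the form $[r,r]$, the number $r\,\frac{g-k}{k^2-1}$ is an integer and $r\le k-1$.
   Context: For integers $2\le k<g$, the labeled directed graph $H(g,k)$ has a distinguished starting node $[[0,0]]$ and other nodes labeled by pairs $[R,r]$ of integers with $0\le R,r\le k-1$ (the node $[0,0]$ is distinct from the starting node). For a node $[P,p]$ (the starting node treated as $[0,0]$ here) there is an edge labeled $(A,a)$ from $[P,p]$ to $[R,r]$ whenever $0\le A,a\le g-1$ are integers, $0\le R,r\le k-1$, $ka+p=A+rg$ and $kA+R=a+Pg$; edges leaving the starting node additionally require $A\ne0\ne a$; no edge enters the starting node. $H(g,k)$ consists of the starting node and all nodes reachable from it. An even pivot node is a node $[a,a]$; an odd pivot node is a node $[r,s]$ with an edge to $[s,r]$; the starting node is not a pivot node. $Y(g,k)$ is obtained from $H(g,k)$ by deleting every node that is not a pivot node and from which no pivot node is reachable, with incident edges. $Y(g,k)$ is a complete Young graph (on $m$ nodes) if its nodes other than the starting node are $m$ nodes forming the complete directed graph on them (an edge from each to each, including self-loops) and there is an edge from the starting node to every node except $[0,0]$. -}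

module Defs where

open import Data.Nat using (ℕ; zero; suc; _+_; _*_; _<_)
open import Data.Product using (Σ; _×_; _,_)
open import Data.Sum using (_⊎_)
open import Data.Empty using (⊥)
open import Data.Unit using (⊤)
open import Relation.Nullary using (¬_)
open import Relation.Binary.PropositionalEquality using (_≡_; _≢_)
open import Relation.Binary.Construct.Closure.ReflexiveTransitive using (Star)

-- Nodes of the graph H(g,k): the distinguished starting node [[0,0]],
-- and nodes [R,r] (the bounds R,r < k are imposed by the edge relation).
data Node : Set where
  start : Node
  node  : ℕ → ℕ → Node

fstC : Node → ℕ
fstC start      = 0
fstC (node P p) = P

sndC : Node → ℕ
sndC start      = 0
sndC (node P p) = p

StartCond : Node → ℕ → ℕ → Set
StartCond start      A a = (A ≢ 0) × (a ≢ 0)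
StartCond (node _ _) A a = ⊤

Edge : ℕ → ℕ → Node → Node → Set
Edge g k u start      = ⊥
Edge g k u (node R r) =
  Σ ℕ λ A → Σ ℕ λ a →
    (A < g) × (a < g) × (R < k) × (r < k) ×
    (k * a + sndC u ≡ A + r * g) ×
    (k * A + R ≡ a + fstC u * g) ×
    StartCond u A a

Reach : ℕ → ℕ → Node → Node → Set
Reach g k = Star (Edge g k)

InH : ℕ → ℕ → Node → Set
InH g k v = Reach g k start v

IsPivot : ℕ → ℕ → Node → Set
IsPivot g k start      = ⊥
IsPivot g k (node r s) = InH g k (node r s) × ((r ≡ s) ⊎ Edge g k (node r s) (node s r))

InY : ℕ → ℕ → Node → Set
InY g k v = InH g k v × Σ Node λ w → Reach g k v w × IsPivot g k w

-- Y(g,k) is a complete Young graph: the starting node is present, the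
-- non-starting nodes form a complete digraph (with loops), and the starting
-- node has an edge to every node except [0,0].
-- (Edges of Y are exactly the edges of H between nodes of Y.)
CompleteYoung : ℕ → ℕ → Set
CompleteYoung g k =
  InY g k start ×
  (∀ P p R r → InY g k (node P p) → InY g k (node R r) →
     Edge g k (node P p) (node R r)) ×
  (∀ R r → InY g k (node R r) → ¬ (node R r ≡ node 0 0) →
     Edge g k start (node R r))

-- Let [r,r] be a node of Y(g,k) and suppose Y(g,k) is complete.
--   * Bound: completeness gives an edge from [r,r] to itself, and every edge
--     target [R,r] of H(g,k) satisfies r < k; hence r ≤ k - 1.
--   * Divisibility: for r = 0 there is nothing to show.  For r ≠ 0 the node
--     differs from [0,0], so completeness gives an edge (A,a) from the
--     starting node (coordinates [0,0]) to [r,r].  Its defining equations read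
--         k·a = A + r·g      and      k·A + r = a.
--     Substituting the second into the first gives k²A + kr = A + rg, i.e.
--         (k² - 1)·A = r·(g - k),
--     so k² - 1 divides r·(g - k).

module Submission where

open import Defs
open import Data.Nat using (ℕ; zero; suc; _+_; _*_; _∸_; _≤_; _<_; s≤s)
open import Data.Nat.Properties
  using (+-identityʳ; +-cancelˡ-≡; *-comm; *-distribˡ-∸; m+n∸n≡m; suc[m]≤n⇒m≤pred[n])
open import Data.Nat.Divisibility using (_∣_; divides; _∣0)
open import Data.Nat.Solver using (module +-*-Solver)
open import Data.Product using (_×_; _,_)
open import Relation.Binary.PropositionalEquality using (_≡_; refl; sym; trans; cong; cong₂; module ≡-Reasoning)

-- Written with
-- k = suc n, so that k·k ∸ 1 computes to n + n·k.
diagonalEdgeIdentity : (n A a r g : ℕ) → let k = suc n in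
  k * a ≡ A + r * g → k * A + r ≡ a → r * (g ∸ k) ≡ A * (k * k ∸ 1)
diagonalEdgeIdentity n A a r g ka≡A+rg kA+r≡a = begin
  r * (g ∸ k)               ≡⟨ *-distribˡ-∸ r g k ⟩
  r * g ∸ r * k             ≡⟨ cong₂ _∸_ (sym cancelled) (*-comm r k) ⟩
  m * A + k * r ∸ k * r     ≡⟨ m+n∸n≡m (m * A) (k * r) ⟩
  m * A                     ≡⟨ *-comm m A ⟩
  A * m                     ∎
  where
  open ≡-Reasoning
  k = suc n
  m = k * k ∸ 1

  -- k·(k·A + r) expanded, with k·k = 1 + m.
  expand : A + (m * A + k * r) ≡ k * (k * A + r)
  expand = solve 3 (λ n A r → A :+ ((n :+ n :* (con 1 :+ n)) :* A :+ (con 1 :+ n) :* r)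
                              := (con 1 :+ n) :* ((con 1 :+ n) :* A :+ r))
                 refl n A r
    where open +-*-Solver

  -- Substituting a = k·A + r into k·a = A + r·g and cancelling A.
  cancelled : m * A + k * r ≡ r * g
  cancelled = +-cancelˡ-≡ A _ _ (trans expand (trans (cong (k *_) kA+r≡a) ka≡A+rg))

edgeTarget< : ∀ g {k} u R {r} → Edge g k u (node R r) → r < k
edgeTarget< _ _ _ (_ , _ , _ , _ , _ , r<k , _) = r<k

startEdgeDivisibility : ∀ {g n r} → let k = suc n in
  Edge g k start (node r r) → (k * k ∸ 1) ∣ (r * (g ∸ k))
startEdgeDivisibility {g} {n} {r} (A , a , _ , _ , _ , _ , ka+0≡A+rg , kA+r≡a+0 , _) =
  divides A (diagonalEdgeIdentity n A a r g
    (trans (sym (+-identityʳ _)) ka+0≡A+rg)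
    (trans kA+r≡a+0 (+-identityʳ a)))

lemma7 : (g k : ℕ) → 2 ≤ k → k < g → CompleteYoung g k →
    (r : ℕ) → InY g k (node r r) →
    ((k * k ∸ 1) ∣ (r * (g ∸ k))) × (r ≤ k ∸ 1)
lemma7 g (suc (suc n)) (s≤s (s≤s _)) _ (_ , complete , fromStart) r r∈Y =
  divisibility r r∈Y , suc[m]≤n⇒m≤pred[n] (edgeTarget< g (node r r) r selfLoop)
  where
  selfLoop : Edge g (suc (suc n)) (node r r) (node r r)
  selfLoop = complete r r r r r∈Y r∈Y

  -- [0,0] is trivial; any other diagonal node is entered from the start.
  divisibility : ∀ d → InY g (suc (suc n)) (node d d) →
    (suc (suc n) * suc (suc n) ∸ 1) ∣ (d * (g ∸ suc (suc n)))
  divisibility zero    _   = _ ∣0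
  divisibility (suc s) s∈Y = startEdgeDivisibility {r = suc s} (fromStart (suc s) (suc s) s∈Y (λ ()))
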